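{- For every integer $n\ge 4$ and every integer $i$, \[|\mathcal{C}_{n}^{i}|=|\mathcal{C}_{n-1}^{i-1}|+|\mathcal{C}_{n-2}^{i-1}|+|\mathcal{C}_{n-3}^{i-1}|.\]
   Context: For an integer $m\ge 3$, $C_m$ denotes the cycle with vertex set $[m]=\{1,2,\dots,m\}$ and edge set $\{\{1,2\},\{2,3\},\dots,\{m-1,m\},\{m,1\}\}$; by convention $C_1$ is the graph with the single vertex $1$, and $C_2$ is the graph on $\{1,2\}$ with the single edge $\{1,2\}$. A set $S$ of vertices of a graph $G$ is a dominating set if every vertex not in $S$ is adjacent to at least one vertex of $S$. For $m\ge1$ and an integer $j$, $\mathcal{C}_m^j$ denotes the family of dominating sets of $C_m$ of cardinality $j$ (so it is empty if $j<0$ or $j>m$). -}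

module Defs where

open import Data.Nat using (ℕ; zero; suc; _≤_; _≤?_)
import Data.Nat as ℕ
open import Data.Integer using (ℤ; +_; -[1+_])
open import Data.Fin using (Fin; toℕ)
open import Data.Fin.Properties using (all?; any?)
open import Data.Fin.Subset using (Subset; _∈_; ∣_∣; inside; outside)
open import Data.Fin.Subset.Properties using (_∈?_)
open import Data.Vec using (Vec; []; _∷_)
open import Data.List using (List; []; _∷_; _++_; map; filter; length)
open import Data.Product using (Σ; ∃; _×_; _,_)
open import Data.Sum using (_⊎_)
open import Relation.Binary.PropositionalEquality using (_≡_)
open import Relation.Nullary using (Dec)
open import Relation.Nullary.Decidable using (_×-dec_; _⊎-dec_)

-- Vertex k : Fin m stands for the vertex (toℕ k + 1) of C_m.
-- Edges of C_m: {k, k+1} for consecutive vertices, plus the wrap-around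
-- edge {m, 1} only when m ≥ 3 (so C_1 has no edge, C_2 the single edge {1,2}).
Adj : (m : ℕ) → Fin m → Fin m → Set
Adj m u v =
  (toℕ v ≡ suc (toℕ u)) ⊎ (toℕ u ≡ suc (toℕ v)) ⊎
  (3 ≤ m × ((toℕ u ≡ 0 × suc (toℕ v) ≡ m) ⊎ (toℕ v ≡ 0 × suc (toℕ u) ≡ m)))

Dominating : (m : ℕ) → Subset m → Set
Dominating m S = ∀ v → v ∈ S ⊎ (∃ λ u → u ∈ S × Adj m u v)

DomOfSize : (m j : ℕ) → Subset m → Set
DomOfSize m j S = Dominating m S × ∣ S ∣ ≡ j

adj? : (m : ℕ) (u v : Fin m) → Dec (Adj m u v)
adj? m u v =
  (toℕ v ℕ.≟ suc (toℕ u)) ⊎-dec (toℕ u ℕ.≟ suc (toℕ v)) ⊎-dec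
  ((3 ≤? m) ×-dec (((toℕ u ℕ.≟ 0) ×-dec (suc (toℕ v) ℕ.≟ m)) ⊎-dec
                   ((toℕ v ℕ.≟ 0) ×-dec (suc (toℕ u) ℕ.≟ m))))

dominating? : (m : ℕ) (S : Subset m) → Dec (Dominating m S)
dominating? m S = all? (λ v → (v ∈? S) ⊎-dec any? (λ u → (u ∈? S) ×-dec adj? m u v))

domOfSize? : (m j : ℕ) (S : Subset m) → Dec (DomOfSize m j S)
domOfSize? m j S = dominating? m S ×-dec (∣ S ∣ ℕ.≟ j)

allSubsets : (m : ℕ) → List (Subset m)
allSubsets zero = [] ∷ []
allSubsets (suc m) = map (inside ∷_) (allSubsets m) ++ map (outside ∷_) (allSubsets m)

numDom : ℕ → ℤ → ℕ
numDom m (+ j) = length (filter (domOfSize? m j) (allSubsets m))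
numDom m -[1+ _ ] = 0

-- Reading a subset of C_m as a binary word, it is dominating iff every cyclic window of
-- three consecutive letters contains a 1.  Such words are the closed walks of length m in
-- the automaton whose state is the pair of the last two letters read, a letter 0 being
-- allowed only if one of them is 1; weighting the letter 1 by x, the domination
-- polynomial of C_m is the trace of T^m for the 4×4 transfer matrix T over ℕ[x].  A
-- direct computation gives T⁴ = x (T³ + T² + T); multiplying by T^m, every entry of
-- T^(m+4), and hence the trace, satisfies the recurrence.
module Submission where

open import Defs
import Algebra.Properties.CommutativeSemigroup as CommutativeSemigroupProperties
open import Data.Bool using (Bool; true; false; T; _∧_; _∨_; if_then_else_)
open import Data.Bool.Properties using (T-∧; T-∨; ∧-zeroʳ; ∨-zeroʳ; ∨-identityʳ)
  renaming (_≟_ to _≟ᵇ_)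
open import Data.Empty using (⊥-elim)
open import Data.Fin as Fin using (Fin; toℕ; fromℕ; fromℕ<)
open import Data.Fin.Properties using (toℕ<n; toℕ-fromℕ; toℕ-fromℕ<)
open import Data.Fin.Subset using (Subset; _∈_; ∣_∣)
open import Data.Integer as ℤ using (ℤ; -[1+_]; _-_; 1ℤ)
open import Data.List using (List; []; _∷_; _++_; map; filter; length)
open import Data.List.Properties using (map-++; map-∘; map-cong)
open import Data.Nat.ListAction using (sum)
open import Data.Nat.ListAction.Properties using (sum-++)
open import Data.Nat using (ℕ; zero; suc; _+_; _∸_; _≤_; _<_; _≡ᵇ_; _≟_; _<?_; z≤n; s≤s)
open import Data.Nat.Properties
  using (+-identityʳ; +-commutativeSemigroup; suc-injective; 1+n≢0; n≤1+n; <⇒≤; ≮⇒≥; ≤∧≢⇒<; <-irrefl)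
open import Data.Product using (∃; _×_; _,_; proj₁; proj₂)
open import Data.Product.Properties using (≡-dec)
open import Data.Sum using (_⊎_; inj₁; inj₂; map₂)
open import Data.Unit using (tt)
open import Data.Vec using (Vec; []; _∷_; here; there)
open import Function using (_∘_; _⇔_; mk⇔; Equivalence)
open import Relation.Binary.Definitions using (DecidableEquality)
open import Relation.Binary.PropositionalEquality
  using (_≡_; refl; sym; trans; cong; cong₂; subst; module ≡-Reasoning)
open import Relation.Nullary using (does; proof; yes; no)
open import Relation.Nullary.Reflects using (det; fromEquivalence)
open import Relation.Unary using (Decidable)

open CommutativeSemigroupProperties +-commutativeSemigroup using (interchange)
open Equivalence using (to; from)
open ≡-Reasoning

𝟙 : Bool → ℕ
𝟙 true  = 1
𝟙 false = 0

length-filter≡sum : ∀ {A : Set} {P : A → Set} (P? : Decidable P) (xs : List A) →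
                    length (filter P? xs) ≡ sum (map (𝟙 ∘ does ∘ P?) xs)
length-filter≡sum P? []       = refl
length-filter≡sum P? (x ∷ xs) with does (P? x)
... | true  = cong suc (length-filter≡sum P? xs)
... | false = length-filter≡sum P? xs

sum-map-+ : ∀ {A : Set} (f g : A → ℕ) (xs : List A) →
            sum (map (λ x → f x + g x) xs) ≡ sum (map f xs) + sum (map g xs)
sum-map-+ f g []       = refl
sum-map-+ f g (x ∷ xs) = trans (cong ((f x + g x) +_) (sum-map-+ f g xs)) (interchange (f x) (g x) _ _)

sum-map-zero : ∀ {A : Set} {f : A → ℕ} (xs : List A) → (∀ x → f x ≡ 0) → sum (map f xs) ≡ 0
sum-map-zero []       _ = refl
sum-map-zero (x ∷ xs) h = cong₂ _+_ (h x) (sum-map-zero xs h)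

Σ-words : (m : ℕ) → (Vec Bool m → ℕ) → ℕ
Σ-words m f = sum (map f (allSubsets m))

Σ-words-cong : ∀ m {f g : Vec Bool m → ℕ} → (∀ w → f w ≡ g w) → Σ-words m f ≡ Σ-words m g
Σ-words-cong m f≗g = cong sum (map-cong f≗g (allSubsets m))

Σ-words-suc : ∀ m (f : Vec Bool (suc m) → ℕ) →
              Σ-words (suc m) f ≡ Σ-words m (f ∘ (true ∷_)) + Σ-words m (f ∘ (false ∷_))
Σ-words-suc m f = begin
    sum (map f (map (true ∷_) ws ++ map (false ∷_) ws))
  ≡⟨ cong sum (map-++ f (map (true ∷_) ws) _) ⟩
    sum (map f (map (true ∷_) ws) ++ map f (map (false ∷_) ws))
  ≡⟨ sum-++ (map f (map (true ∷_) ws)) _ ⟩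
    sum (map f (map (true ∷_) ws)) + sum (map f (map (false ∷_) ws))
  ≡⟨ sym (cong₂ _+_ (cong sum (map-∘ ws)) (cong sum (map-∘ ws))) ⟩
    Σ-words m (f ∘ (true ∷_)) + Σ-words m (f ∘ (false ∷_))
  ∎
  where ws = allSubsets m

-- Polynomials with coefficients in ℕ

Poly : Set
Poly = List ℕ

coeff : Poly → ℕ → ℕ
coeff []      _       = 0
coeff (a ∷ p) zero    = a
coeff (a ∷ p) (suc j) = coeff p j

infixl 6 _⊕_
infixr 8 X·_

_⊕_ : Poly → Poly → Poly
[]      ⊕ q       = q
(a ∷ p) ⊕ []      = a ∷ p
(a ∷ p) ⊕ (b ∷ q) = a + b ∷ p ⊕ q

X·_ : Poly → Poly
X· p = 0 ∷ p

when : Bool → Poly → Poly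
when c p = if c then p else []

coeff-⊕ : ∀ p q j → coeff (p ⊕ q) j ≡ coeff p j + coeff q j
coeff-⊕ []      q       j       = refl
coeff-⊕ (a ∷ p) []      j       = sym (+-identityʳ _)
coeff-⊕ (a ∷ p) (b ∷ q) zero    = refl
coeff-⊕ (a ∷ p) (b ∷ q) (suc j) = coeff-⊕ p q j

coeff-⊕₃ : ∀ p q r j → coeff (p ⊕ q ⊕ r) j ≡ coeff p j + coeff q j + coeff r j
coeff-⊕₃ p q r j = trans (coeff-⊕ (p ⊕ q) r j) (cong (_+ coeff r j) (coeff-⊕ p q j))

-- A record rather than a definition, so that its four indices can be inferred at use sites.
record Recurrence (p₄ p₃ p₂ p₁ : Poly) : Set where
  constructor recurrence
  field coeff-recurrence : ∀ j → coeff p₄ j ≡ coeff (X· (p₃ ⊕ p₂ ⊕ p₁)) j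
open Recurrence

Recurrence-X· : ∀ {p₄ p₃ p₂ p₁} → Recurrence p₄ p₃ p₂ p₁ → Recurrence (X· p₄) (X· p₃) (X· p₂) (X· p₁)
-- X· p ⊕ X· q computes to X· (p ⊕ q).
Recurrence-X· h = recurrence λ where
  zero    → refl
  (suc j) → coeff-recurrence h j

Recurrence-when : ∀ {p₄ p₃ p₂ p₁} c → Recurrence p₄ p₃ p₂ p₁ →
                  Recurrence (when c p₄) (when c p₃) (when c p₂) (when c p₁)
Recurrence-when true  h = h
Recurrence-when false _ = recurrence λ where
  zero    → refl
  (suc _) → refl

Recurrence-⊕ : ∀ {p₄ p₃ p₂ p₁ q₄ q₃ q₂ q₁} → Recurrence p₄ p₃ p₂ p₁ → Recurrence q₄ q₃ q₂ q₁ →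
               Recurrence (p₄ ⊕ q₄) (p₃ ⊕ q₃) (p₂ ⊕ q₂) (p₁ ⊕ q₁)
Recurrence-⊕ {p₄} {p₃} {p₂} {p₁} {q₄} {q₃} {q₂} {q₁} (recurrence hp) (recurrence hq) =
  recurrence sum-step
  where
  sum-step : ∀ j → coeff (p₄ ⊕ q₄) j ≡ coeff (X· ((p₃ ⊕ q₃) ⊕ (p₂ ⊕ q₂) ⊕ (p₁ ⊕ q₁))) j
  sum-step zero    = trans (coeff-⊕ p₄ q₄ 0) (cong₂ _+_ (hp 0) (hq 0))
  sum-step (suc j) = begin
      coeff (p₄ ⊕ q₄) (suc j)
    ≡⟨ coeff-⊕ p₄ q₄ (suc j) ⟩
      coeff p₄ (suc j) + coeff q₄ (suc j)
    ≡⟨ cong₂ _+_ (hp (suc j)) (hq (suc j)) ⟩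
      coeff (p₃ ⊕ p₂ ⊕ p₁) j + coeff (q₃ ⊕ q₂ ⊕ q₁) j
    ≡⟨ cong₂ _+_ (coeff-⊕₃ p₃ p₂ p₁ j) (coeff-⊕₃ q₃ q₂ q₁ j) ⟩
      (c p₃ + c p₂ + c p₁) + (c q₃ + c q₂ + c q₁)
    ≡⟨ trans (interchange (c p₃ + c p₂) (c p₁) (c q₃ + c q₂) (c q₁))
             (cong (_+ (c p₁ + c q₁)) (interchange (c p₃) (c p₂) (c q₃) (c q₂))) ⟩
      (c p₃ + c q₃) + (c p₂ + c q₂) + (c p₁ + c q₁)
    ≡⟨ sym (trans (coeff-⊕₃ (p₃ ⊕ q₃) (p₂ ⊕ q₂) (p₁ ⊕ q₁) j)
                  (cong₂ _+_ (cong₂ _+_ (coeff-⊕ p₃ q₃ j) (coeff-⊕ p₂ q₂ j)) (coeff-⊕ p₁ q₁ j))) ⟩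
      coeff ((p₃ ⊕ q₃) ⊕ (p₂ ⊕ q₂) ⊕ (p₁ ⊕ q₁)) j
    ∎
    where
    c : Poly → ℕ
    c p = coeff p j

-- The automaton and its walks

State : Set
State = Bool × Bool

_≟ₛ_ : DecidableEquality State
_≟ₛ_ = ≡-dec _≟ᵇ_ _≟ᵇ_

covered : ∀ {m} → State → Vec Bool m → Bool
covered s       []          = true
covered (a , b) (true ∷ w)  = covered (b , true) w
covered (a , b) (false ∷ w) = (a ∨ b) ∧ covered (b , false) w

ends : ∀ {m} → State → Vec Bool m → State
ends s       []      = s
ends (a , b) (c ∷ w) = ends (b , c) w

-- The order of the conjuncts lets Σ-states-select and coeff-walks go through by computation.
accepts : ∀ {m} → State → State → ℕ → Vec Bool m → Bool
accepts s t j w = does (ends s w ≟ₛ t) ∧ covered s w ∧ (∣ w ∣ ≡ᵇ j)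

-- The (s , t) entry of T^m.
walks : ℕ → State → State → Poly
walks zero    s       t = when (does (s ≟ₛ t)) (1 ∷ [])
walks (suc m) (a , b) t = X· walks m (b , true) t ⊕ when (a ∨ b) (walks m (b , false) t)

coeff-walks : ∀ m s t j → coeff (walks m s t) j ≡ Σ-words m (𝟙 ∘ accepts s t j)
coeff-walks zero s t j with does (s ≟ₛ t) | j
... | false | _     = refl
... | true  | zero  = refl
... | true  | suc _ = refl
coeff-walks (suc m) (a , b) t j = begin
    coeff (X· walks m (b , true) t ⊕ when (a ∨ b) (walks m (b , false) t)) j
  ≡⟨ coeff-⊕ (X· walks m (b , true) t) (when (a ∨ b) (walks m (b , false) t)) j ⟩
    coeff (X· walks m (b , true) t) j + coeff (when (a ∨ b) (walks m (b , false) t)) j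
  ≡⟨ cong₂ _+_ (reading-true j) reading-false ⟩
    Σ-words m (𝟙 ∘ accepts (a , b) t j ∘ (true ∷_)) + Σ-words m (𝟙 ∘ accepts (a , b) t j ∘ (false ∷_))
  ≡⟨ sym (Σ-words-suc m _) ⟩
    Σ-words (suc m) (𝟙 ∘ accepts (a , b) t j)
  ∎
  where
  reading-true : ∀ j → coeff (X· walks m (b , true) t) j ≡
                       Σ-words m (𝟙 ∘ accepts (a , b) t j ∘ (true ∷_))
  reading-true zero    = sym (sum-map-zero (allSubsets m) λ w →
                           cong 𝟙 (trans (cong (does (ends (b , true) w ≟ₛ t) ∧_)
                                               (∧-zeroʳ (covered (b , true) w)))
                                         (∧-zeroʳ _)))
  reading-true (suc j) = coeff-walks m (b , true) t j

  -- Stated unfolded so that `with` can abstract over a ∨ b.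
  reading-false : coeff (when (a ∨ b) (walks m (b , false) t)) j ≡
                  Σ-words m (λ w → 𝟙 (does (ends (b , false) w ≟ₛ t) ∧
                                      ((a ∨ b) ∧ covered (b , false) w) ∧ (∣ w ∣ ≡ᵇ j)))
  reading-false with a ∨ b
  ... | true  = coeff-walks m (b , false) t j
  ... | false = sym (sum-map-zero (allSubsets m) λ w → cong 𝟙 (∧-zeroʳ _))

walks-base : ∀ s t → walks 4 s t ≡ X· (walks 3 s t ⊕ walks 2 s t ⊕ walks 1 s t)
walks-base (false , false) (false , false) = refl
walks-base (false , false) (false , true)  = refl
walks-base (false , false) (true  , false) = refl
walks-base (false , false) (true  , true)  = refl
walks-base (false , true)  (false , false) = refl
walks-base (false , true)  (false , true)  = refl
walks-base (false , true)  (true  , false) = refl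
walks-base (false , true)  (true  , true)  = refl
walks-base (true  , false) (false , false) = refl
walks-base (true  , false) (false , true)  = refl
walks-base (true  , false) (true  , false) = refl
walks-base (true  , false) (true  , true)  = refl
walks-base (true  , true)  (false , false) = refl
walks-base (true  , true)  (false , true)  = refl
walks-base (true  , true)  (true  , false) = refl
walks-base (true  , true)  (true  , true)  = refl

walks-recurrence : ∀ m s t →
  Recurrence (walks (4 + m) s t) (walks (3 + m) s t) (walks (2 + m) s t) (walks (1 + m) s t)
walks-recurrence zero    s       t = recurrence λ j → cong (λ p → coeff p j) (walks-base s t)
walks-recurrence (suc m) (a , b) t =
  Recurrence-⊕ (Recurrence-X· (walks-recurrence m (b , true) t))
               (Recurrence-when (a ∨ b) (walks-recurrence m (b , false) t))

Σ-states : (State → ℕ) → ℕ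
Σ-states g = g (false , false) + (g (false , true) + (g (true , false) + g (true , true)))

Σ-states-cong : ∀ {g h : State → ℕ} → (∀ s → g s ≡ h s) → Σ-states g ≡ Σ-states h
Σ-states-cong g≗h =
  cong₂ _+_ (g≗h _) (cong₂ _+_ (g≗h _) (cong₂ _+_ (g≗h _) (g≗h _)))

Σ-states-select : ∀ (f : State → Bool) e → 𝟙 (f e) ≡ Σ-states (λ s → 𝟙 (does (e ≟ₛ s) ∧ f s))
Σ-states-select f (false , false) = sym (+-identityʳ _)
Σ-states-select f (false , true)  = sym (+-identityʳ _)
Σ-states-select f (true  , false) = sym (+-identityʳ _)
Σ-states-select f (true  , true)  = refl

Σ-words-Σ-states : ∀ m (g : State → Vec Bool m → ℕ) →
                   Σ-words m (λ w → Σ-states (λ s → g s w)) ≡ Σ-states (λ s → Σ-words m (g s))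
Σ-words-Σ-states m g =
  trans (sum-map-+ (g (false , false)) _ ws) (cong (Σ-words m (g (false , false)) +_)
  (trans (sum-map-+ (g (false , true)) _ ws) (cong (Σ-words m (g (false , true)) +_)
         (sum-map-+ (g (true , false)) (g (true , true)) ws))))
  where ws = allSubsets m

⨁-states : (State → Poly) → Poly
⨁-states f = f (false , false) ⊕ (f (false , true) ⊕ (f (true , false) ⊕ f (true , true)))

coeff-⨁-states : ∀ f j → coeff (⨁-states f) j ≡ Σ-states (λ s → coeff (f s) j)
coeff-⨁-states f j =
  trans (coeff-⊕ (f (false , false)) _ j) (cong (coeff (f (false , false)) j +_)
  (trans (coeff-⊕ (f (false , true)) _ j) (cong (coeff (f (false , true)) j +_)
         (coeff-⊕ (f (true , false)) _ j))))

Recurrence-⨁-states : ∀ (P : ℕ → State → Poly) m →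
                      (∀ s → Recurrence (P (4 + m) s) (P (3 + m) s) (P (2 + m) s) (P (1 + m) s)) →
                      Recurrence (⨁-states (P (4 + m))) (⨁-states (P (3 + m)))
                                 (⨁-states (P (2 + m))) (⨁-states (P (1 + m)))
Recurrence-⨁-states P m h =
  Recurrence-⊕ (h (false , false)) (Recurrence-⊕ (h (false , true))
  (Recurrence-⊕ (h (true , false)) (h (true , true))))

closedWalks : ℕ → State → Poly
closedWalks m s = walks m s s

cyclePoly : ℕ → Poly
cyclePoly m = ⨁-states (closedWalks m)

cyclePoly-recurrence : ∀ m →
  Recurrence (cyclePoly (4 + m)) (cyclePoly (3 + m)) (cyclePoly (2 + m)) (cyclePoly (1 + m))
cyclePoly-recurrence m = Recurrence-⨁-states closedWalks m (λ s → walks-recurrence m s s)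

-- Windows of a word and domination in the cycle

infixl 10 _!_

-- Positions past the end read as true, so windows overhanging the end hold vacuously.
_!_ : ∀ {n} → Vec Bool n → ℕ → Bool
[]      ! _     = true
(x ∷ w) ! zero  = x
(x ∷ w) ! suc i = w ! i

window : ∀ {n} → Vec Bool n → ℕ → Bool
window u i = u ! i ∨ u ! suc i ∨ u ! suc (suc i)

T-window : ∀ {n} (u : Vec Bool n) i → T (window u i) ⇔ (T (u ! i) ⊎ T (u ! suc i) ⊎ T (u ! suc (suc i)))
T-window u i = mk⇔ (map₂ (to T-∨) ∘ to T-∨) (from T-∨ ∘ map₂ (from T-∨))

covered-∷ : ∀ a b c {m} (w : Vec Bool m) →
            covered (a , b) (c ∷ w) ≡ window (a ∷ b ∷ c ∷ w) 0 ∧ covered (b , c) w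
covered-∷ a b true  w =
  cong (_∧ covered (b , true) w) (sym (trans (cong (a ∨_) (∨-zeroʳ b)) (∨-zeroʳ a)))
covered-∷ a b false w =
  cong (λ x → (a ∨ x) ∧ covered (b , false) w) (sym (∨-identityʳ b))

covered⇒windows : ∀ a b {m} (w : Vec Bool m) → T (covered (a , b) w) → ∀ i → T (window (a ∷ b ∷ w) i)
covered⇒windows a b []      _ zero          = from (T-window (a ∷ b ∷ []) 0) (inj₂ (inj₂ tt))
covered⇒windows a b []      _ (suc zero)    = from (T-window (a ∷ b ∷ []) 1) (inj₂ (inj₂ tt))
covered⇒windows a b []      _ (suc (suc i)) = tt
covered⇒windows a b (c ∷ w) h zero          = proj₁ (to T-∧ (subst T (covered-∷ a b c w) h))
covered⇒windows a b (c ∷ w) h (suc i)       =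
  covered⇒windows b c w (proj₂ (to T-∧ (subst T (covered-∷ a b c w) h))) i

windows⇒covered : ∀ a b {m} (w : Vec Bool m) → (∀ i → T (window (a ∷ b ∷ w) i)) → T (covered (a , b) w)
windows⇒covered a b []      _ = tt
windows⇒covered a b (c ∷ w) h =
  subst T (sym (covered-∷ a b c w)) (from T-∧ (h 0 , windows⇒covered b c w (h ∘ suc)))

∈⇒letter : ∀ {n} {w : Subset n} {u t} → u ∈ w → toℕ u ≡ t → T (w ! t)
∈⇒letter here        refl = tt
∈⇒letter (there u∈w) refl = ∈⇒letter u∈w refl

letter⇒∈ : ∀ {n} (w : Subset n) u {t} → toℕ u ≡ t → T (w ! t) → u ∈ w
letter⇒∈ (true ∷ w)  Fin.zero    refl _ = here
letter⇒∈ (false ∷ w) Fin.zero    refl ()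
letter⇒∈ (x ∷ w)     (Fin.suc u) refl t = there (letter⇒∈ w u refl t)

!-beyond : ∀ {n} (w : Vec Bool n) {i} → n ≤ i → T (w ! i)
!-beyond []      _         = tt
!-beyond (x ∷ w) (s≤s n≤i) = !-beyond w n≤i

Dominated : (m : ℕ) → Subset m → Fin m → Set
Dominated m S v = v ∈ S ⊎ ∃ λ u → u ∈ S × Adj m u v

module _ (r : ℕ) (w : Subset (3 + r)) where

  -- w preceded by its last two letters: window i is centred on the vertex i - 1 (mod 3 + r).
  wrapped : Vec Bool (5 + r)
  wrapped = w ! suc r ∷ w ! suc (suc r) ∷ w

  private
    3≤ : 3 ≤ 3 + r
    3≤ = s≤s (s≤s (s≤s z≤n))

  dominated⇒window₀ : ∀ v → toℕ v ≡ suc (suc r) → Dominated (3 + r) w v → T (window wrapped 0)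
  dominated⇒window₀ v e (inj₁ v∈w) = from (T-window wrapped 0) (inj₂ (inj₁ (∈⇒letter v∈w e)))
  dominated⇒window₀ v e (inj₂ (u , u∈w , inj₁ v≡1+u)) =
    from (T-window wrapped 0) (inj₁ (∈⇒letter u∈w (suc-injective (trans (sym v≡1+u) e))))
  dominated⇒window₀ v e (inj₂ (u , u∈w , inj₂ (inj₁ u≡1+v))) =
    ⊥-elim (<-irrefl (trans u≡1+v (cong suc e)) (toℕ<n u))
  dominated⇒window₀ v e (inj₂ (u , u∈w , inj₂ (inj₂ (_ , inj₁ (u≡0 , _))))) =
    from (T-window wrapped 0) (inj₂ (inj₂ (∈⇒letter u∈w u≡0)))
  dominated⇒window₀ v e (inj₂ (u , u∈w , inj₂ (inj₂ (_ , inj₂ (v≡0 , _))))) =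
    ⊥-elim (1+n≢0 (trans (sym e) v≡0))

  window₀⇒dominated : ∀ v → toℕ v ≡ suc (suc r) → T (window wrapped 0) → Dominated (3 + r) w v
  window₀⇒dominated v e t with to (T-window wrapped 0) t
  ... | inj₁ t₁ = inj₂ (fromℕ< r+1< , letter⇒∈ w _ (toℕ-fromℕ< r+1<) t₁ ,
                        inj₁ (trans e (cong suc (sym (toℕ-fromℕ< r+1<)))))
    where
    r+1< : suc r < 3 + r
    r+1< = s≤s (s≤s (n≤1+n r))
  ... | inj₂ (inj₁ t₂) = inj₁ (letter⇒∈ w v e t₂)
  ... | inj₂ (inj₂ t₃) =
    inj₂ (Fin.zero , letter⇒∈ w Fin.zero refl t₃ , inj₂ (inj₂ (3≤ , inj₁ (refl , cong suc e))))

  dominated⇒window : ∀ v {k} → toℕ v ≡ k → suc k < 3 + r →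
                     Dominated (3 + r) w v → T (window wrapped (suc k))
  dominated⇒window v refl _ (inj₁ v∈w) =
    from (T-window wrapped (suc (toℕ v))) (inj₂ (inj₁ (∈⇒letter v∈w refl)))
  dominated⇒window v refl _ (inj₂ (u , u∈w , inj₁ v≡1+u)) =
    from (T-window wrapped (suc (toℕ v)))
         (inj₁ (subst (λ k → T (wrapped ! suc k)) (sym v≡1+u) (∈⇒letter u∈w refl)))
  dominated⇒window v refl _ (inj₂ (u , u∈w , inj₂ (inj₁ u≡1+v))) =
    from (T-window wrapped (suc (toℕ v))) (inj₂ (inj₂ (∈⇒letter u∈w u≡1+v)))
  dominated⇒window v refl lt (inj₂ (u , u∈w , inj₂ (inj₂ (_ , inj₁ (_ , 1+v≡n))))) =
    ⊥-elim (<-irrefl 1+v≡n lt)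
  dominated⇒window v refl _ (inj₂ (u , u∈w , inj₂ (inj₂ (_ , inj₂ (v≡0 , 1+u≡n))))) =
    from (T-window wrapped (suc (toℕ v)))
         (inj₁ (subst (λ k → T (wrapped ! suc k)) (sym v≡0) (∈⇒letter u∈w (suc-injective 1+u≡n))))

  predecessor : ∀ v → T (wrapped ! suc (toℕ v)) → ∃ λ u → u ∈ w × Adj (3 + r) u v
  predecessor v t with toℕ v in e
  ... | zero  = fromℕ (suc (suc r)) , letter⇒∈ w _ (toℕ-fromℕ _) t ,
                inj₂ (inj₂ (3≤ , inj₂ (refl , cong suc (toℕ-fromℕ _))))
  ... | suc k = fromℕ< k< , letter⇒∈ w _ (toℕ-fromℕ< k<) t , inj₁ (cong suc (sym (toℕ-fromℕ< k<)))
    where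
    k< : k < 3 + r
    k< = <⇒≤ (subst (_< 3 + r) e (toℕ<n v))

  window⇒dominated : ∀ v → suc (toℕ v) < 3 + r → T (window wrapped (suc (toℕ v))) → Dominated (3 + r) w v
  window⇒dominated v lt t with to (T-window wrapped (suc (toℕ v))) t
  ... | inj₁ t₁        = inj₂ (predecessor v t₁)
  ... | inj₂ (inj₁ t₂) = inj₁ (letter⇒∈ w v refl t₂)
  ... | inj₂ (inj₂ t₃) = inj₂ (fromℕ< lt , letter⇒∈ w _ (toℕ-fromℕ< lt) t₃ , inj₂ (inj₁ (toℕ-fromℕ< lt)))

  dominating⇒windows : Dominating (3 + r) w → ∀ i → T (window wrapped i)
  dominating⇒windows D zero = dominated⇒window₀ (fromℕ _) (toℕ-fromℕ _) (D _)
  dominating⇒windows D (suc k) with suc k <? 3 + r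
  ... | yes lt = dominated⇒window (fromℕ< (<⇒≤ lt)) (toℕ-fromℕ< (<⇒≤ lt)) lt (D _)
  ... | no ≮   = from (T-window wrapped (suc k)) (inj₂ (inj₂ (!-beyond w (≮⇒≥ ≮))))

  windows⇒dominating : (∀ i → T (window wrapped i)) → Dominating (3 + r) w
  windows⇒dominating h v with toℕ v ≟ suc (suc r)
  ... | yes v≡last = window₀⇒dominated v v≡last (h 0)
  ... | no  v≢last = window⇒dominated v (≤∧≢⇒< (toℕ<n v) (v≢last ∘ suc-injective)) (h (suc (toℕ v)))

lastTwo : ∀ {n} → Vec Bool (2 + n) → State
lastTwo {n} w = w ! n , w ! suc n

ends≡lastTwo : ∀ {n} s (w : Vec Bool (2 + n)) → ends s w ≡ lastTwo w
ends≡lastTwo {zero}  (a , b) (x ∷ y ∷ []) = refl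
ends≡lastTwo {suc n} (a , b) (x ∷ w)      = ends≡lastTwo (b , x) w

dominating?≡covered : ∀ r (w : Subset (3 + r)) → does (dominating? (3 + r) w) ≡ covered (lastTwo w) w
dominating?≡covered r w = det (proof (dominating? (3 + r) w)) (fromEquivalence
  (windows⇒dominating r w ∘ covered⇒windows _ _ w)
  (windows⇒covered _ _ w ∘ dominating⇒windows r w))

-- Dominating sets of the cycle as closed walks

accepts-diagonal : ∀ {n} j (w : Vec Bool (2 + n)) →
                   𝟙 (covered (lastTwo w) w ∧ (∣ w ∣ ≡ᵇ j)) ≡ Σ-states (λ s → 𝟙 (accepts s s j w))
accepts-diagonal j w = begin
    𝟙 (covered (lastTwo w) w ∧ (∣ w ∣ ≡ᵇ j))
  ≡⟨ Σ-states-select (λ s → covered s w ∧ (∣ w ∣ ≡ᵇ j)) (lastTwo w) ⟩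
    Σ-states (λ s → 𝟙 (does (lastTwo w ≟ₛ s) ∧ covered s w ∧ (∣ w ∣ ≡ᵇ j)))
  ≡⟨ Σ-states-cong (λ s → cong (λ e → 𝟙 (does (e ≟ₛ s) ∧ covered s w ∧ (∣ w ∣ ≡ᵇ j)))
                               (sym (ends≡lastTwo s w))) ⟩
    Σ-states (λ s → 𝟙 (accepts s s j w))
  ∎

numDom≡coeff-cyclePoly-3+ : ∀ r j → numDom (3 + r) (ℤ.+ j) ≡ coeff (cyclePoly (3 + r)) j
numDom≡coeff-cyclePoly-3+ r j = begin
    numDom (3 + r) (ℤ.+ j)
  ≡⟨ length-filter≡sum (domOfSize? (3 + r) j) (allSubsets (3 + r)) ⟩
    Σ-words (3 + r) (λ w → 𝟙 (does (dominating? (3 + r) w) ∧ (∣ w ∣ ≡ᵇ j)))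
  ≡⟨ Σ-words-cong (3 + r) (λ w → cong (λ b → 𝟙 (b ∧ (∣ w ∣ ≡ᵇ j))) (dominating?≡covered r w)) ⟩
    Σ-words (3 + r) (λ w → 𝟙 (covered (lastTwo w) w ∧ (∣ w ∣ ≡ᵇ j)))
  ≡⟨ Σ-words-cong (3 + r) (accepts-diagonal j) ⟩
    Σ-words (3 + r) (λ w → Σ-states (λ s → 𝟙 (accepts s s j w)))
  ≡⟨ Σ-words-Σ-states (3 + r) (λ s → 𝟙 ∘ accepts s s j) ⟩
    Σ-states (λ s → Σ-words (3 + r) (𝟙 ∘ accepts s s j))
  ≡⟨ Σ-states-cong (λ s → sym (coeff-walks (3 + r) s s j)) ⟩
    Σ-states (λ s → coeff (walks (3 + r) s s) j)
  ≡⟨ sym (coeff-⨁-states (closedWalks (3 + r)) j) ⟩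
    coeff (cyclePoly (3 + r)) j
  ∎

-- C_1 and C_2 have no wrap-around edge, so the window argument does not apply to them;
-- they are checked by evaluation.
numDom≡coeff-cyclePoly : ∀ m j → numDom (suc m) (ℤ.+ j) ≡ coeff (cyclePoly (suc m)) j
numDom≡coeff-cyclePoly zero          zero                = refl
numDom≡coeff-cyclePoly zero          (suc zero)          = refl
numDom≡coeff-cyclePoly zero          (suc (suc _))       = refl
numDom≡coeff-cyclePoly (suc zero)    zero                = refl
numDom≡coeff-cyclePoly (suc zero)    (suc zero)          = refl
numDom≡coeff-cyclePoly (suc zero)    (suc (suc zero))    = refl
numDom≡coeff-cyclePoly (suc zero)    (suc (suc (suc _))) = refl
numDom≡coeff-cyclePoly (suc (suc r)) j                   = numDom≡coeff-cyclePoly-3+ r j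

theorem2 : (n : ℕ) → 4 ≤ n → (i : ℤ) →
    numDom n i ≡ numDom (n ∸ 1) (i - 1ℤ) + numDom (n ∸ 2) (i - 1ℤ) + numDom (n ∸ 3) (i - 1ℤ)
theorem2 (suc (suc (suc (suc m)))) (s≤s (s≤s (s≤s (s≤s z≤n)))) -[1+ _ ] = refl
theorem2 (suc (suc (suc (suc m)))) (s≤s (s≤s (s≤s (s≤s z≤n)))) (ℤ.+ zero) = begin
    numDom (4 + m) (ℤ.+ 0)      ≡⟨ numDom≡coeff-cyclePoly (3 + m) 0 ⟩
    coeff (cyclePoly (4 + m)) 0 ≡⟨ coeff-recurrence (cyclePoly-recurrence m) 0 ⟩
    0                           ∎
theorem2 (suc (suc (suc (suc m)))) (s≤s (s≤s (s≤s (s≤s z≤n)))) (ℤ.+ suc j) = begin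
    numDom (4 + m) (ℤ.+ suc j)
  ≡⟨ numDom≡coeff-cyclePoly (3 + m) (suc j) ⟩
    coeff (cyclePoly (4 + m)) (suc j)
  ≡⟨ coeff-recurrence (cyclePoly-recurrence m) (suc j) ⟩
    coeff (cyclePoly (3 + m) ⊕ cyclePoly (2 + m) ⊕ cyclePoly (1 + m)) j
  ≡⟨ coeff-⊕₃ (cyclePoly (3 + m)) (cyclePoly (2 + m)) (cyclePoly (1 + m)) j ⟩
    coeff (cyclePoly (3 + m)) j + coeff (cyclePoly (2 + m)) j + coeff (cyclePoly (1 + m)) j
  ≡⟨ sym (cong₂ _+_ (cong₂ _+_ (numDom≡coeff-cyclePoly (2 + m) j) (numDom≡coeff-cyclePoly (1 + m) j))
                    (numDom≡coeff-cyclePoly m j)) ⟩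
    numDom (3 + m) (ℤ.+ j) + numDom (2 + m) (ℤ.+ j) + numDom (1 + m) (ℤ.+ j)
  ∎
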